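{- Let $G$ be a connected bipartite graph with $|V(G)|>2$ that has a perfect matching. If $evc(G)=mvc(G)$, then $G$ has no vertex of degree one.
   Context: All graphs are finite, simple and undirected. $mvc(G)$ denotes the size of a minimum vertex cover of $G$. Eternal vertex cover game: a defender first places guards on a subset of vertices; then in each round an attacker attacks an edge, and the defender must respond by moving guards, each guard moving at most one step along an edge (any number of guards may move simultaneously), such that at least one guard moves across the attacked edge; if this is impossible the attacker wins, and the defender wins if she can respond to every attack of an infinite sequence. $evc(G)$ is the minimum number of guards for which the defender has a winning strategy. -}

module Defs where

open import Data.Nat using (ℕ; _≤_)
open import Data.Bool using (Bool; true; false)
open import Data.Fin using (Fin)
open import Data.Fin.Subset using (Subset; _∈_; ∣_∣)
open import Data.Vec using (tabulate)
open import Data.Product using (Σ; ∃; _×_; _,_)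
open import Data.Sum using (_⊎_)
open import Relation.Binary.PropositionalEquality using (_≡_; _≢_)
open import Level using (Level; suc; zero)

record Graph (n : ℕ) : Set where
  field
    E     : Fin n → Fin n → Bool
    sym   : ∀ u v → E u v ≡ E v u
    irrefl : ∀ u → E u u ≡ false

module _ {n : ℕ} (G : Graph n) where
  open Graph G

  Adj : Fin n → Fin n → Set
  Adj u v = E u v ≡ true

  degree : Fin n → ℕ
  degree v = ∣ tabulate (λ u → E v u) ∣

  data Walk : Fin n → Fin n → Set where
    here : ∀ {u} → Walk u u
    step : ∀ {u v w} → Adj u v → Walk v w → Walk u w

  Connected : Set
  Connected = ∀ u v → Walk u v

  Bipartite : Set
  Bipartite = Σ (Fin n → Bool) λ c → ∀ u v → Adj u v → c u ≢ c v

  HasPerfectMatching : Set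
  HasPerfectMatching = Σ (Fin n → Fin n) λ m → (∀ v → Adj v (m v)) × (∀ v → m (m v) ≡ v)

  IsVertexCover : Subset n → Set
  IsVertexCover C = ∀ u v → Adj u v → u ∈ C ⊎ v ∈ C

  MvcIs : ℕ → Set
  MvcIs k = (Σ (Subset n) λ C → IsVertexCover C × ∣ C ∣ ≡ k)
          × (∀ C → IsVertexCover C → k ≤ ∣ C ∣)

  -- Defender's response to an attack on edge {u,v}: guards occupy the
  -- vertex set C (at most one guard per vertex); the guard at x moves to f x,
  -- which is x itself or a neighbour of x; distinct guards end on distinct
  -- vertices; the new configuration is C' = f(C); and some guard crosses the
  -- attacked edge.
  Response : Subset n → Subset n → Fin n → Fin n → Set
  Response C C' u v = Σ (Fin n → Fin n) λ f →
      (∀ x → x ∈ C → f x ≡ x ⊎ Adj x (f x))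
    × (∀ x y → x ∈ C → y ∈ C → f x ≡ f y → x ≡ y)
    × (∀ y → y ∈ C' → Σ (Fin n) λ x → x ∈ C × f x ≡ y)
    × (∀ x → x ∈ C → f x ∈ C')
    × ((u ∈ C × f u ≡ v) ⊎ (v ∈ C × f v ≡ u))

  -- The defender has a winning strategy with k guards: there is a nonempty
  -- family of k-guard configurations closed under responding to any attack.
  -- (Finite perfect-information game: the set of defender-winning positions.)
  DefenderWins : ℕ → Set₁
  DefenderWins k = Σ (Subset n → Set) λ P →
      (Σ (Subset n) P)
    × (∀ C → P C → ∣ C ∣ ≡ k)
    × (∀ C → P C → ∀ u v → Adj u v → Σ (Subset n) λ C' → P C' × Response C C' u v)

  EvcIs : ℕ → Set₁
  EvcIs k = DefenderWins k × (∀ j → DefenderWins j → k ≤ j)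

-- Let v be a leaf with neighbour u. A minimum vertex cover never contains both u and v,
-- since v could be dropped. If evc = mvc, every guard configuration of a winning strategy is a
-- minimum cover, so it guards exactly one of u, v. Connectivity and n > 2 give a second
-- neighbour w of u. If v is guarded, attack uw: the guard on w must move to u, and the guard
-- on v can neither stay (u and v would both be guarded) nor move to its only neighbour u (two
-- guards would collide). If u is guarded, attack uv: its guard moves to v, and either both are
-- guarded or we are in the previous situation.
module Submission where

open import Defs
open import Data.Nat using (ℕ; suc; _≤_; _<_; z≤n; s≤s)
open import Data.Nat.Properties using (≤-trans; <-irrefl; <-≤-trans)
open import Data.Fin using (Fin; zero; _≟_; punchIn; punchOut)
open import Data.Fin.Properties using (punchInᵢ≢i; punchIn-injective; punchIn-punchOut)
open import Data.Fin.Subset using (Subset; _∈_; _∉_; ∣_∣; _-_)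
open import Data.Fin.Subset.Properties using (_∈?_; x∈p∧x≢y⇒x∈p-y; x∈p⇒∣p-x∣<∣p∣)
open import Data.Bool using (Bool; true)
open import Data.Vec using (tabulate)
open import Data.Vec.Properties using (lookup⇒[]=; lookup∘tabulate)
open import Data.Product using (Σ; ∃-syntax; _×_; _,_)
open import Function using (_∘′_)
open import Data.Sum using (_⊎_; inj₁; inj₂; [_,_]′; swap)
open import Data.Empty using (⊥)
open import Relation.Nullary using (¬_; yes; no; contradiction)
open import Relation.Nullary.Decidable using (_⊎-dec_)
open import Relation.Unary using (Pred; Decidable)
open import Relation.Binary.PropositionalEquality using (_≡_; _≢_; refl; sym; trans; subst)

∃≢₂ : ∀ {n} → 2 < n → (u v : Fin n) → ∃[ w ] w ≢ u × w ≢ v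
∃≢₂ {1} (s≤s ()) _ _
∃≢₂ {2} (s≤s (s≤s ())) _ _
∃≢₂ {suc (suc (suc m))} _ u v with v ≟ u
... | yes refl = punchIn u zero , punchInᵢ≢i u zero , punchInᵢ≢i u zero
... | no v≢u = punchIn u j′ , punchInᵢ≢i u j′ , punchInᵢ≢i j zero ∘′ punchIn-injective u j′ j ∘′ at-v
  where
  u≢v : u ≢ v
  u≢v = v≢u ∘′ sym
  -- v is punchIn u j, and any j′ ≢ j is mapped by punchIn u to a third vertex
  j j′ : Fin (suc (suc m))
  j = punchOut u≢v
  j′ = punchIn j zero
  at-v : punchIn u j′ ≡ v → punchIn u j′ ≡ punchIn u j
  at-v eq = trans eq (sym (punchIn-punchOut u≢v))

∈-tabulate⁺ : ∀ {n} {f : Fin n → Bool} {i : Fin n} → f i ≡ true → i ∈ tabulate f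
∈-tabulate⁺ {f = f} {i} fi = lookup⇒[]= i (tabulate f) (trans (lookup∘tabulate f i) fi)

x∈p⇒1≤∣p∣ : ∀ {n} {x : Fin n} {p : Subset n} → x ∈ p → 1 ≤ ∣ p ∣
x∈p⇒1≤∣p∣ x∈p = ≤-trans (s≤s z≤n) (x∈p⇒∣p-x∣<∣p∣ x∈p)

x∈p∧y∈p∧x≢y⇒2≤∣p∣ : ∀ {n} {x y : Fin n} {p : Subset n} → x ∈ p → y ∈ p → x ≢ y → 2 ≤ ∣ p ∣
x∈p∧y∈p∧x≢y⇒2≤∣p∣ x∈p y∈p x≢y =
  <-≤-trans (s≤s (x∈p⇒1≤∣p∣ (x∈p∧x≢y⇒x∈p-y y∈p (x≢y ∘′ sym)))) (x∈p⇒∣p-x∣<∣p∣ x∈p)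

module _ {n : ℕ} (G : Graph n) where

  Adj-sym : ∀ {x y} → Adj G x y → Adj G y x
  Adj-sym {x} {y} xy = trans (Graph.sym G y x) xy

  Adj⇒≢ : ∀ {x y} → Adj G x y → x ≢ y
  Adj⇒≢ {x} xx refl = contradiction (trans (sym xx) (Graph.irrefl G x)) λ ()

  walk-exits : ∀ {ℓ} {P : Pred (Fin n) ℓ} → Decidable P → ∀ {a b} → Walk G a b → ¬ P a → P b →
    ∃[ y ] ∃[ z ] Adj G y z × ¬ P y × P z
  walk-exits P? here ¬Pa Pb = contradiction Pb ¬Pa
  walk-exits P? {a} (step {v = c} ac walk) ¬Pa Pb with P? c
  ... | yes Pc = a , c , ac , ¬Pa , Pc
  ... | no ¬Pc = walk-exits P? walk ¬Pc Pb

  degree≡1⇒neighbour-unique : ∀ {v x y} → degree G v ≡ 1 → Adj G v x → Adj G v y → x ≡ y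
  degree≡1⇒neighbour-unique {x = x} {y} deg vx vy with x ≟ y
  ... | yes x≡y = x≡y
  ... | no x≢y with subst (2 ≤_) deg (x∈p∧y∈p∧x≢y⇒2≤∣p∣ (∈-tabulate⁺ vx) (∈-tabulate⁺ vy) x≢y)
  ...   | s≤s ()

  leaf-support-has-other-neighbour : Connected G → 2 < n → ∀ {v u} → Adj G v u →
    (∀ y → Adj G v y → y ≡ u) → ∃[ w ] Adj G u w × w ≢ v
  leaf-support-has-other-neighbour connected 2<n {v} {u} vu leaf
    with ∃≢₂ 2<n u v
  ... | x , x≢u , x≢v
    with walk-exits (λ y → (y ≟ u) ⊎-dec (y ≟ v)) (connected x v) [ x≢u , x≢v ]′ (inj₂ refl)
  ... | y , .u , yu , y∉uv , inj₁ refl = y , Adj-sym yu , y∉uv ∘′ inj₂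
  ... | y , .v , yv , y∉uv , inj₂ refl = contradiction (inj₁ (leaf y (Adj-sym yv))) y∉uv

  cover-without : ∀ {C v} → IsVertexCover G C → (∀ y → Adj G v y → y ∈ C) →
    IsVertexCover G (C - v)
  cover-without {C} {v} cover N[v]⊆C a b ab =
    [ (λ a∈C → keep a∈C ab) , (λ b∈C → swap (keep b∈C (Adj-sym ab))) ]′ (cover a b ab)
    where
    keep : ∀ {x y} → x ∈ C → Adj G x y → x ∈ C - v ⊎ y ∈ C - v
    keep {x} {y} x∈C xy with x ≟ v
    ... | yes refl = inj₂ (x∈p∧x≢y⇒x∈p-y (N[v]⊆C y xy) (Adj⇒≢ xy ∘′ sym))
    ... | no x≢v = inj₁ (x∈p∧x≢y⇒x∈p-y x∈C x≢v)

  minimum-cover-⊉-closed-neighbourhood : ∀ {k C v} → MvcIs G k → IsVertexCover G C → ∣ C ∣ ≡ k →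
    v ∈ C → ¬ (∀ y → Adj G v y → y ∈ C)
  minimum-cover-⊉-closed-neighbourhood (_ , minimum) cover refl v∈C N[v]⊆C =
    <-irrefl refl (<-≤-trans (x∈p⇒∣p-x∣<∣p∣ v∈C) (minimum _ (cover-without cover N[v]⊆C)))

  response-endpoint-guarded : ∀ {C C′ u v} → Response G C C′ u v → u ∈ C ⊎ v ∈ C
  response-endpoint-guarded (_ , _ , _ , _ , _ , inj₁ (u∈C , _)) = inj₁ u∈C
  response-endpoint-guarded (_ , _ , _ , _ , _ , inj₂ (v∈C , _)) = inj₂ v∈C

  module LeafGame {k : ℕ} (mvc : MvcIs G k)
    (P : Subset n → Set) (size : ∀ C → P C → ∣ C ∣ ≡ k)
    (respond : ∀ C → P C → ∀ a b → Adj G a b → Σ (Subset n) λ C′ → P C′ × Response G C C′ a b)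
    {v u w : Fin n} (vu : Adj G v u) (leaf : ∀ y → Adj G v y → y ≡ u) (uw : Adj G u w) (w≢v : w ≢ v)
    where

    configuration-cover : ∀ {C} → P C → IsVertexCover G C
    configuration-cover {C} PC a b ab with respond C PC a b ab
    ... | _ , _ , response = response-endpoint-guarded response

    ¬leaf∧support : ∀ {C} → P C → v ∈ C → u ∈ C → ⊥
    ¬leaf∧support {C} PC v∈C u∈C =
      minimum-cover-⊉-closed-neighbourhood mvc (configuration-cover PC) (size C PC) v∈C
        (λ y vy → subst (_∈ C) (sym (leaf y vy)) u∈C)

    ¬leaf-only : ∀ {C} → P C → v ∈ C → u ∉ C → ⊥
    ¬leaf-only {C} PC v∈C u∉C with respond C PC u w uw
    ... | _ , _ , _ , _ , _ , _ , _ , inj₁ (u∈C , _) = u∉C u∈C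
    ... | C′ , PC′ , f , moves , injective , _ , into , inj₂ (w∈C , fw≡u) with moves v v∈C
    ...   | inj₁ fv≡v =
      ¬leaf∧support PC′ (subst (_∈ C′) fv≡v (into v v∈C)) (subst (_∈ C′) fw≡u (into w w∈C))
    ...   | inj₂ v-fv = w≢v (sym (injective v w v∈C w∈C (trans (leaf (f v) v-fv) (sym fw≡u))))

    ¬support-only : ∀ {C} → P C → u ∈ C → v ∉ C → ⊥
    ¬support-only {C} PC u∈C v∉C with respond C PC u v (Adj-sym vu)
    ... | _ , _ , _ , _ , _ , _ , _ , inj₂ (v∈C , _) = v∉C v∈C
    ... | C′ , PC′ , _ , _ , _ , _ , into , inj₁ (_ , fu≡v) with u ∈? C′
    ...   | yes u∈C′ = ¬leaf∧support PC′ (subst (_∈ C′) fu≡v (into u u∈C)) u∈C′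
    ...   | no u∉C′ = ¬leaf-only PC′ (subst (_∈ C′) fu≡v (into u u∈C)) u∉C′

    ¬configuration : ∀ {C} → ¬ P C
    ¬configuration {C} PC with v ∈? C | u ∈? C
    ... | yes v∈C | yes u∈C = ¬leaf∧support PC v∈C u∈C
    ... | yes v∈C | no u∉C = ¬leaf-only PC v∈C u∉C
    ... | no v∉C | yes u∈C = ¬support-only PC u∈C v∉C
    ... | no v∉C | no u∉C = [ v∉C , u∉C ]′ (configuration-cover PC v u vu)

proposition5 : (n : ℕ) (G : Graph n) → Connected G → Bipartite G → 2 < n
    → HasPerfectMatching G
    → (k : ℕ) → EvcIs G k → MvcIs G k
    → (v : Fin n) → degree G v ≢ 1
proposition5 _ G connected _ 2<n (partner , matched , _) _
             ((P , (_ , PC) , size , respond) , _) mvc v deg =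
  let (w , uw , w≢v) = leaf-support-has-other-neighbour G connected 2<n (matched v) leaf
  in LeafGame.¬configuration G mvc P size respond (matched v) leaf uw w≢v PC
  where
  leaf : ∀ y → Adj G v y → y ≡ partner v
  leaf y vy = degree≡1⇒neighbour-unique G deg vy (matched v)
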